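{- Let $M$ be a finite planar map whose faces are properly colored black and white (no two faces sharing an edge have the same color), with each edge oriented so that it runs clockwise around the black face incident to it. Let $o$ be a distinguished vertex of $M$ (the origin) and let $\mathcal{B}$ be a set of edges of $M$ (the blocked edges) such that every vertex of $M$ can be reached from $o$ by a directed path using only edges not in $\mathcal{B}$, each traversed in its orientation. For a vertex $v$ let $d(v)$ be the minimal length of such a directed path from $o$ to $v$. Construct a graph $\mathcal{M}$ as follows: place a new vertex $c_f$ (colored like $f$) inside each face $f$ of $M$; then for each edge $e$ of $M$, oriented from $u$ to $w$, with black incident face $f_b$ and white incident face $f_w$: (i) if $e\in\mathcal{B}$, add an edge $c_{f_b}c_{f_w}$ (called marked); (ii) if $e\notin\mathcal{B}$ and $d(w)\le d(u)$, add an edge $c_{f_b}c_{f_w}$ (unmarked); (iii) if $e\notin\mathcal{B}$ and $d(w)=d(u)+1$, add an edge from $c_{f_w}$ to the vertex $w$ of $M$. (For $e\notin\mathcal{B}$ one always has $d(w)\le d(u)+1$.) The vertex set of $\mathcal{M}$ consists of all the $c_f$ together with all vertices of $M$ that are endpoints of edges of type (iii). Then $\mathcal{M}$, drawn in the plane, is a tree, and its vertices coming from $M$ are exactly all the vertices of $M$ other than $o$.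
   Context: Planar maps are connected graphs embedded in the sphere, considered up to orientation-preserving homeomorphism. Each edge of $M$ is incident to exactly one black face and one white face. In (i)–(ii) the added edges are drawn crossing $e$; in (iii) the added edge is drawn inside $f_w$ ending at $w$. -}

module Defs where

open import Data.Nat using (ℕ; zero; suc; _+_; _*_; _≤_; _≤ᵇ_)
open import Data.Fin using (Fin)
open import Data.Bool using (Bool; true; false; if_then_else_; _∨_)
open import Data.Product using (Σ; ∃; _×_; _,_; proj₁; proj₂)
open import Data.Sum using (_⊎_; inj₁; inj₂)
open import Data.Unit using (⊤)
open import Data.List using (List; []; _∷_; length)
open import Data.List.Relation.Unary.Unique.Propositional using (Unique)
open import Relation.Binary.PropositionalEquality using (_≡_; _≢_)
open import Relation.Nullary using (¬_)
open import Function.Bundles using (_⇔_)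

iter : {A : Set} → (A → A) → ℕ → A → A
iter f zero    x = x
iter f (suc k) x = f (iter f k x)

SameOrbit : {A : Set} → (A → A) → A → A → Set
SameOrbit f x y = ∃ λ k → iter f k x ≡ y

data Conn {n : ℕ} (σ α : Fin n → Fin n) (x : Fin n) : Fin n → Set where
  here  : Conn σ α x x
  stepσ : ∀ {y} → Conn σ α x y → Conn σ α x (σ y)
  stepα : ∀ {y} → Conn σ α x y → Conn σ α x (α y)

-- Darts: Fin nD.  σ : rotation of darts COUNTERCLOCKWISE around their
-- origin vertex.  α : the fixed-point-free involution reversing a dart.
-- φ = σ ∘ α : the face permutation; the φ-orbit of a dart d is the face
-- lying to the RIGHT of d (traversed clockwise).
-- Vertices (σ-orbits) and faces (φ-orbits) are labelled explicitly by
-- Fin nV and Fin nF; the map with one vertex and no edge has nD = 0,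
-- nV = 1, nF = 1.  Planarity (genus 0) is Euler's formula
-- nV - nE + nF = 2 with nD = 2 nE.

record PlanarMap : Set where
  field
    nD : ℕ
    σ σ⁻ α : Fin nD → Fin nD
    σσ⁻ : ∀ d → σ (σ⁻ d) ≡ d
    σ⁻σ : ∀ d → σ⁻ (σ d) ≡ d
    αα  : ∀ d → α (α d) ≡ d
    α-nofix : ∀ d → α d ≢ d
    nV : ℕ
    vtx : Fin nD → Fin nV
    vtx-orbit : ∀ d d' → (vtx d ≡ vtx d') ⇔ SameOrbit σ d d'
    vtx-onto : (∀ v → ∃ λ d → vtx d ≡ v) ⊎ (nD ≡ 0 × nV ≡ 1)
    nF : ℕ
    face : Fin nD → Fin nF
    face-orbit : ∀ d d' → (face d ≡ face d') ⇔ SameOrbit (λ x → σ (α x)) d d'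
    face-onto : (∀ f → ∃ λ d → face d ≡ f) ⊎ (nD ≡ 0 × nF ≡ 1)
    connected : ∀ d d' → Conn σ α d d'
    euler : 2 * (nV + nF) ≡ nD + 4

module Graph {Vt E : Set} (ends : E → Vt × Vt) where

  Joins : E → Vt → Vt → Set
  Joins e x y = (proj₁ (ends e) ≡ x × proj₂ (ends e) ≡ y)
              ⊎ (proj₁ (ends e) ≡ y × proj₂ (ends e) ≡ x)

  data Walk : Vt → Vt → Set where
    []    : ∀ {x} → Walk x x
    _∷⟨_⟩_ : ∀ {x y z} (e : E) → Joins e x y → Walk y z → Walk x z

  walkEdges : ∀ {x z} → Walk x z → List E
  walkEdges []            = []
  walkEdges (e ∷⟨ _ ⟩ w) = e ∷ walkEdges w

  walkVerts : ∀ {x z} → Walk x z → List Vt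
  walkVerts []                     = []
  walkVerts (_∷⟨_⟩_ {y = y} e _ w) = y ∷ walkVerts w

  Cycle : Set
  Cycle = Σ Vt λ x → Σ (Walk x x) λ w →
            (1 ≤ length (walkEdges w)) × Unique (walkEdges w) × Unique (walkVerts w)

  IsTree : (Vt → Set) → Set
  IsTree InV = (∀ e → InV (proj₁ (ends e)) × InV (proj₂ (ends e)))
             × (∀ x y → InV x → InV y → Walk x y)
             × ¬ Cycle

module Setting (M : PlanarMap) (colour : Fin (PlanarMap.nF M) → Bool)
               (blocked : Fin (PlanarMap.nD M) → Bool)
               (o : Fin (PlanarMap.nV M)) where
  open PlanarMap M

  -- colour true = black.  An edge is represented by its dart d having
  -- the black face on its right (so d runs clockwise around it), i.e.
  -- d is oriented from u = vtx d to w = vtx (α d), f_b = face d,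
  -- f_w = face (α d).
  ProperColouring : Set
  ProperColouring = ∀ d → colour (face d) ≢ colour (face (α d))

  BlackDart : Set
  BlackDart = Σ (Fin nD) λ d → colour (face d) ≡ true

  data Reach : Fin nV → ℕ → Set where
    start : Reach o 0
    step  : ∀ {k} (d : Fin nD) → colour (face d) ≡ true → blocked d ≡ false →
            Reach (vtx d) k → Reach (vtx (α d)) (suc k)

  IsDist : Fin nV → ℕ → Set
  IsDist v k = Reach v k × (∀ j → Reach v j → k ≤ j)

  -- vertices of 𝓜: face centres c_f (inj₁) and vertices of M (inj₂)
  MVert : Set
  MVert = Fin nF ⊎ Fin nV

  edgeEnds : (Fin nV → ℕ) → BlackDart → MVert × MVert
  edgeEnds dist (d , _) =
    if blocked d ∨ (dist (vtx (α d)) ≤ᵇ dist (vtx d))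
    then (inj₁ (face d) , inj₁ (face (α d)))
    else (inj₁ (face (α d)) , inj₂ (vtx (α d)))

  InMVert : (Fin nV → ℕ) → MVert → Set
  InMVert dist (inj₁ f) = ⊤
  InMVert dist (inj₂ v) = ∃ λ (e : BlackDart) →
    (proj₁ (edgeEnds dist e) ≡ inj₂ v) ⊎ (proj₂ (edgeEnds dist e) ≡ inj₂ v)

-- A vertex v ≠ o is joined in 𝓜 to the white face of the last edge of a
-- shortest path from o to v. Turning around v, every edge met either is crossed by an edge of
-- 𝓜 or is of type (iii) leading to a vertex one step further from o, which by downward
-- induction on the distance is already linked to both faces beside that edge. So the faces
-- around v are linked to v, hence faces adjacent across any edge are linked, and all centres
-- lie in one component.
-- Acyclicity is counting. 𝓜 has one edge per edge of M, i.e. nE = nD / 2 edges, and Euler's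
-- formula gives nF + nV = nE + 2. Deleting an edge of a cycle keeps 𝓜 connected, so its
-- nE - 1 remaining edges would leave the nF + nV points (the vertices of 𝓜 and the isolated
-- origin) in at most two classes, forcing nF + nV ≤ nE + 1.

module Submission where

open import Defs
open import Data.Nat using (ℕ; zero; suc; _+_; _*_; _≤_; _<_; _≤ᵇ_; _⊔_; z≤n; s≤s)
open import Data.Nat.Properties
open import Data.Nat.Tactic.RingSolver using (solve-∀)
open import Data.Fin using (Fin; zero; suc; join; splitAt)
open import Data.Fin.Properties using (any?; join-splitAt) renaming (_≟_ to _≟ᶠ_)
open import Data.Fin.Permutation using (permutation)
open import Data.Bool using (Bool; true; false; not; _∨_; T; if_then_else_)
open import Data.Bool.Properties using (∨-conicalˡ; ∨-conicalʳ)
open import Data.Product using (Σ; ∃; _×_; _,_; proj₁; proj₂)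
open import Data.Sum as ⊎ using (_⊎_; inj₁; inj₂)
open import Data.Empty using (⊥; ⊥-elim)
open import Data.Unit using (tt)
open import Data.List.Relation.Unary.All as All using (All; []; _∷_)
open import Data.List.Relation.Unary.AllPairs using (_∷_)
open import Relation.Nullary using (¬_; yes; no)
open import Relation.Nullary.Decidable using (⌊_⌋)
open import Relation.Binary.PropositionalEquality
open import Axiom.UniquenessOfIdentityProofs.WithK using (uip)
open import Function using (_∘_)
open import Function.Bundles using (_⇔_; Equivalence; mk⇔)
open import Algebra.Properties.CommutativeMonoid.Sum +-0-commutativeMonoid
  using (sum; sum-permute; sum-cong-≗)

indicator : Bool → ℕ
indicator true  = 1
indicator false = 0

count : ∀ {n} → (Fin n → Bool) → ℕ
count p = sum (indicator ∘ p)

_⊆_ : ∀ {n} → (Fin n → Bool) → (Fin n → Bool) → Set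
p ⊆ q = ∀ i → p i ≡ true → q i ≡ true

indicator-mono : ∀ {a b} → (a ≡ true → b ≡ true) → indicator a ≤ indicator b
indicator-mono {false}         _ = z≤n
indicator-mono {true} {true}   _ = ≤-refl
indicator-mono {true} {false} a⇒b with a⇒b refl
... | ()

indicator≤1 : ∀ a → indicator a ≤ 1
indicator≤1 true  = ≤-refl
indicator≤1 false = z≤n

count-mono : ∀ {n} {p q : Fin n → Bool} → p ⊆ q → count p ≤ count q
count-mono {zero}  p⊆q = z≤n
count-mono {suc n} p⊆q = +-mono-≤ (indicator-mono (p⊆q zero)) (count-mono (p⊆q ∘ suc))

count-full : ∀ {n} {p : Fin n → Bool} → (∀ i → p i ≡ true) → n ≤ count p
count-full {zero}  _ = z≤n
count-full {suc n} {p} full rewrite full zero = s≤s (count-full (full ∘ suc))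

count-empty : ∀ {n} {p : Fin n → Bool} → (∀ i → p i ≢ true) → count p ≡ 0
count-empty {zero}  _ = refl
count-empty {suc n} {p} empty with p zero in p₀
... | true  = ⊥-elim (empty zero p₀)
... | false = count-empty (empty ∘ suc)

count-insert : ∀ {n} {p q : Fin n → Bool} (c : Fin n) →
               (∀ i → p i ≡ true → q i ≡ true ⊎ i ≡ c) → count p ≤ suc (count q)
count-insert {suc n} {p} {q} zero p⊆q∪c =
  +-mono-≤ (indicator≤1 (p zero)) (≤-trans (count-mono p⊆q) (m≤n+m _ (indicator (q zero))))
  where
  p⊆q : (p ∘ suc) ⊆ (q ∘ suc)
  p⊆q i pi with p⊆q∪c (suc i) pi
  ... | inj₁ qi = qi
count-insert {suc n} {p} {q} (suc c) p⊆q∪c =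
  subst (count p ≤_) (+-suc (indicator (q zero)) _)
    (+-mono-≤ (indicator-mono head) (count-insert c tail))
  where
  head : p zero ≡ true → q zero ≡ true
  head p₀ with p⊆q∪c zero p₀
  ... | inj₁ q₀ = q₀
  tail : ∀ i → p (suc i) ≡ true → q (suc i) ≡ true ⊎ i ≡ c
  tail i pi with p⊆q∪c (suc i) pi
  ... | inj₁ qi   = inj₁ qi
  ... | inj₂ refl = inj₂ refl

count≤2 : ∀ {n} {p : Fin n → Bool} (a b : Fin n) →
          (∀ i → p i ≡ true → i ≡ a ⊎ i ≡ b) → count p ≤ 2
count≤2 {n} {p} a b p⊆ab = begin
  count p                       ≤⟨ count-insert b p⊆a∪b ⟩
  suc (count isA)               ≤⟨ s≤s (count-insert a a⊆∅∪a) ⟩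
  2 + count {n} (λ _ → false)   ≡⟨ cong (2 +_) (count-empty {n} {λ _ → false} λ _ ()) ⟩
  2                             ∎
  where
  open ≤-Reasoning
  isA : Fin _ → Bool
  isA i = ⌊ i ≟ᶠ a ⌋
  p⊆a∪b : ∀ i → p i ≡ true → isA i ≡ true ⊎ i ≡ b
  p⊆a∪b i pi with p⊆ab i pi
  ... | inj₂ i≡b = inj₂ i≡b
  ... | inj₁ i≡a with i ≟ᶠ a
  ...   | yes _  = inj₁ refl
  ...   | no i≢a = ⊥-elim (i≢a i≡a)
  a⊆∅∪a : ∀ i → isA i ≡ true → false ≡ true ⊎ i ≡ a
  a⊆∅∪a i isAi with i ≟ᶠ a
  ... | yes i≡a = inj₂ i≡a
  a⊆∅∪a i () | no _

count-strict : ∀ {n} {p q : Fin n → Bool} (c : Fin n) → p ⊆ q →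
               p c ≡ false → q c ≡ true → suc (count p) ≤ count q
count-strict {suc n} zero p⊆q p₀ q₀ rewrite p₀ | q₀ = s≤s (count-mono (p⊆q ∘ suc))
count-strict {suc n} {p} {q} (suc c) p⊆q pc qc =
  subst (_≤ count q) (+-suc (indicator (p zero)) _)
    (+-mono-≤ (indicator-mono (p⊆q zero)) (count-strict c (p⊆q ∘ suc) pc qc))

count-complement : ∀ {n} (p : Fin n → Bool) → count p + count (not ∘ p) ≡ n
count-complement {zero}  p = refl
count-complement {suc n} p with p zero
... | true  = cong suc (count-complement (p ∘ suc))
... | false = trans (+-suc (count (p ∘ suc)) _) (cong suc (count-complement (p ∘ suc)))

count-half : ∀ {n} (p : Fin n → Bool) (α : Fin n → Fin n) →
             (∀ i → α (α i) ≡ i) → (∀ i → p (α i) ≡ not (p i)) → count p + count p ≡ n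
count-half {n} p α αα swap = begin
  count p + count p          ≡⟨ cong (count p +_) (sum-permute (indicator ∘ p) (permutation α α αα αα)) ⟩
  count p + count (p ∘ α)    ≡⟨ cong (count p +_) (sum-cong-≗ (cong indicator ∘ swap)) ⟩
  count p + count (not ∘ p)  ≡⟨ count-complement p ⟩
  n                          ∎
  where open ≡-Reasoning

inImage : ∀ {m n} → (Fin m → Fin n) → Fin n → Bool
inImage r l = ⌊ any? (λ x → r x ≟ᶠ l) ⌋

imageSize : ∀ {m n} → (Fin m → Fin n) → ℕ
imageSize r = count (inImage r)

inImage-intro : ∀ {m n} (r : Fin m → Fin n) x → inImage r (r x) ≡ true
inImage-intro r x with any? (λ y → r y ≟ᶠ r x)
... | yes _     = refl
... | no ∄preim = ⊥-elim (∄preim (x , refl))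

inImage-elim : ∀ {m n} (r : Fin m → Fin n) l → inImage r l ≡ true → ∃ λ x → r x ≡ l
inImage-elim r l _ with any? (λ x → r x ≟ᶠ l)
inImage-elim r l () | no _
... | yes preim = preim

imageSize-id : ∀ {n} → n ≤ imageSize {n} (λ x → x)
imageSize-id = count-full (inImage-intro (λ x → x))

imageSize≤2 : ∀ {m n} (r : Fin m → Fin n) a b → (∀ x → r x ≡ r a ⊎ r x ≡ r b) → imageSize r ≤ 2
imageSize≤2 r a b twoValues = count≤2 (r a) (r b) λ l l∈im →
  let x , rx≡l = inImage-elim r l l∈im
  in ⊎.map (trans (sym rx≡l)) (trans (sym rx≡l)) (twoValues x)

module _ {N : ℕ} where

  merge : Fin N → Fin N → (Fin N → Fin N) → Fin N → Fin N
  merge a b r x with r x ≟ᶠ r b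
  ... | yes _ = r a
  ... | no  _ = r x

  merge-identifies : ∀ a b r → merge a b r a ≡ merge a b r b
  merge-identifies a b r with r a ≟ᶠ r b | r b ≟ᶠ r b
  ... | yes _ | yes _    = refl
  ... | no  _ | yes _    = refl
  ... | _     | no rb≢rb = ⊥-elim (rb≢rb refl)

  merge-preserves : ∀ a b r {x y} → r x ≡ r y → merge a b r x ≡ merge a b r y
  merge-preserves a b r {x} {y} rx≡ry with r x ≟ᶠ r b | r y ≟ᶠ r b
  ... | yes _  | yes _  = refl
  ... | no _   | no _   = rx≡ry
  ... | yes rx | no ry  = ⊥-elim (ry (trans (sym rx≡ry) rx))
  ... | no rx  | yes ry = ⊥-elim (rx (trans rx≡ry ry))

  imageSize-merge : ∀ a b r → imageSize r ≤ suc (imageSize (merge a b r))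
  imageSize-merge a b r = count-insert (r b) λ l l∈im →
    let x , rx≡l = inImage-elim r l l∈im in survives x l rx≡l
    where
    survives : ∀ x l → r x ≡ l → inImage (merge a b r) l ≡ true ⊎ l ≡ r b
    survives x l rx≡l with r x ≟ᶠ r b in eq
    ... | yes rx≡rb = inj₂ (trans (sym rx≡l) rx≡rb)
    ... | no _      =
      inj₁ (subst (λ z → inImage (merge a b r) z ≡ true) merged (inImage-intro (merge a b r) x))
      where
      merged : merge a b r x ≡ l
      merged rewrite eq = rx≡l

  mergeAll : ∀ {K} → (Fin K → Fin N × Fin N) → (Fin K → Bool) → (Fin N → Fin N) → Fin N → Fin N
  mergeAll {zero}  ends present r = r
  mergeAll {suc K} ends present r =
    mergeAll (ends ∘ suc) (present ∘ suc) (mergeIf (present zero) (ends zero))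
    where
    mergeIf : Bool → Fin N × Fin N → Fin N → Fin N
    mergeIf true  (a , b) = merge a b r
    mergeIf false _       = r

  Respects : ∀ {K} → (Fin K → Fin N × Fin N) → (Fin K → Bool) → (Fin N → Fin N) → Set
  Respects ends present r = ∀ k → present k ≡ true → r (proj₁ (ends k)) ≡ r (proj₂ (ends k))

  mergeAll-preserves : ∀ {K} ends present r {x y} →
                       r x ≡ r y → mergeAll {K} ends present r x ≡ mergeAll ends present r y
  mergeAll-preserves {zero}  ends present r rx≡ry = rx≡ry
  mergeAll-preserves {suc K} ends present r rx≡ry with present zero | ends zero
  ... | true  | a , b = mergeAll-preserves (ends ∘ suc) (present ∘ suc) _ (merge-preserves a b r rx≡ry)
  ... | false | _     = mergeAll-preserves (ends ∘ suc) (present ∘ suc) r rx≡ry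

  mergeAll-respects : ∀ {K} ends present r → Respects {K} ends present (mergeAll ends present r)
  mergeAll-respects {suc K} ends present r zero present₀ with present zero | ends zero
  mergeAll-respects {suc K} ends present r zero ()       | false | _
  ... | true | a , b = mergeAll-preserves (ends ∘ suc) (present ∘ suc) _ (merge-identifies a b r)
  mergeAll-respects {suc K} ends present r (suc k) presentₖ with present zero | ends zero
  ... | true  | a , b = mergeAll-respects (ends ∘ suc) (present ∘ suc) (merge a b r) k presentₖ
  ... | false | _     = mergeAll-respects (ends ∘ suc) (present ∘ suc) r k presentₖ

  imageSize-mergeAll : ∀ {K} ends present r →
                       imageSize r ≤ count present + imageSize (mergeAll {K} ends present r)
  imageSize-mergeAll {zero}  ends present r = ≤-refl
  imageSize-mergeAll {suc K} ends present r with present zero | ends zero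
  ... | true  | a , b = ≤-trans (imageSize-merge a b r)
                          (s≤s (imageSize-mergeAll (ends ∘ suc) (present ∘ suc) (merge a b r)))
  ... | false | _     = imageSize-mergeAll (ends ∘ suc) (present ∘ suc) r

  -- The hypothesis says that the graph has at most two connected components, those of a and b.
  vertices≤edges+2 : ∀ {K} (ends : Fin K → Fin N × Fin N) (present : Fin K → Bool) (a b : Fin N) →
    (∀ r → Respects ends present r → ∀ x → r x ≡ r a ⊎ r x ≡ r b) → N ≤ count present + 2
  vertices≤edges+2 {K} ends present a b twoComponents = begin
    N                                    ≤⟨ imageSize-id {N} ⟩
    imageSize {N} (λ x → x)              ≤⟨ imageSize-mergeAll {K} ends present (λ x → x) ⟩
    count present + imageSize classes    ≤⟨ +-monoʳ-≤ (count present) (imageSize≤2 classes a b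
                                             (twoComponents classes (mergeAll-respects ends present _))) ⟩
    count present + 2                    ∎
    where
    open ≤-Reasoning
    classes : Fin N → Fin N
    classes = mergeAll ends present (λ x → x)

module Walks {Vt E : Set} (ends : E → Vt × Vt) where
  open Graph ends

  _++ʷ_ : ∀ {x y z} → Walk x y → Walk y z → Walk x z
  []               ++ʷ w = w
  (e ∷⟨ j ⟩ w₁) ++ʷ w = e ∷⟨ j ⟩ (w₁ ++ʷ w)

  Joins-sym : ∀ {e x y} → Joins e x y → Joins e y x
  Joins-sym (inj₁ (a , b)) = inj₂ (a , b)
  Joins-sym (inj₂ (a , b)) = inj₁ (a , b)

  reverseʷ : ∀ {x y} → Walk x y → Walk y x
  reverseʷ []             = []
  reverseʷ (e ∷⟨ j ⟩ w) = reverseʷ w ++ʷ (e ∷⟨ Joins-sym {e} j ⟩ [])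

  edgeʷ : ∀ e {x y} → proj₁ (ends e) ≡ x → proj₂ (ends e) ≡ y → Walk x y
  edgeʷ e refl refl = e ∷⟨ inj₁ (refl , refl) ⟩ []

  substʷ : ∀ {x x' y y'} → x ≡ x' → y ≡ y' → Walk x y → Walk x' y'
  substʷ refl refl w = w

  EdgeInvariant : {A : Set} → (Vt → A) → E → Set
  EdgeInvariant f e = f (proj₁ (ends e)) ≡ f (proj₂ (ends e))

  walk-invariant : {A : Set} (f : Vt → A) → ∀ {x y} (w : Walk x y) →
                   All (EdgeInvariant f) (walkEdges w) → f x ≡ f y
  walk-invariant f []                             []        = refl
  walk-invariant f (e ∷⟨ inj₁ (refl , refl) ⟩ w) (fe ∷ fw) = trans fe (walk-invariant f w fw)
  walk-invariant f (e ∷⟨ inj₂ (refl , refl) ⟩ w) (fe ∷ fw) = trans (sym fe) (walk-invariant f w fw)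

  Joins⇒EdgeInvariant : {A : Set} (f : Vt → A) → ∀ {e x y} →
                        Joins e x y → f x ≡ f y → EdgeInvariant f e
  Joins⇒EdgeInvariant f (inj₁ (refl , refl)) fx≡fy = fx≡fy
  Joins⇒EdgeInvariant f (inj₂ (refl , refl)) fx≡fy = sym fx≡fy

  walk-invariant-all : {A : Set} (f : Vt → A) → (∀ e → EdgeInvariant f e) →
                       ∀ {x y} → Walk x y → f x ≡ f y
  walk-invariant-all f inv w = walk-invariant f w (allEdges w)
    where
    allEdges : ∀ {x y} (w : Walk x y) → All (EdgeInvariant f) (walkEdges w)
    allEdges []             = []
    allEdges (e ∷⟨ _ ⟩ w) = inv e ∷ allEdges w

Fin1-unique : ∀ {n} → n ≡ 1 → (a b : Fin n) → a ≡ b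
Fin1-unique refl zero zero = refl

iter-suc : ∀ {A : Set} (f : A → A) k x → iter f (suc k) x ≡ iter f k (f x)
iter-suc f zero    x = refl
iter-suc f (suc k) x = cong f (iter-suc f k x)

maximum : ∀ {n} → (Fin n → ℕ) → ℕ
maximum {zero}  f = 0
maximum {suc n} f = f zero ⊔ maximum (f ∘ suc)

≤-maximum : ∀ {n} (f : Fin n → ℕ) i → f i ≤ maximum f
≤-maximum f zero    = m≤m⊔n _ _
≤-maximum f (suc i) = ≤-trans (≤-maximum (f ∘ suc) i) (m≤n⊔m _ _)

≤ᵇ≡false⇒> : ∀ m n → (m ≤ᵇ n) ≡ false → n < m
≤ᵇ≡false⇒> m n eq = ≰⇒> λ m≤n → subst T eq (≤⇒≤ᵇ m≤n)

>⇒≤ᵇ≡false : ∀ m n → n < m → (m ≤ᵇ n) ≡ false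
>⇒≤ᵇ≡false m n n<m with m ≤ᵇ n in eq
... | false = refl
... | true  = ⊥-elim (<⇒≱ n<m (≤ᵇ⇒≤ m n (subst T (sym eq) tt)))

module Construction (M : PlanarMap) (colour : Fin (PlanarMap.nF M) → Bool)
  (blocked : Fin (PlanarMap.nD M) → Bool) (o : Fin (PlanarMap.nV M))
  (proper : Setting.ProperColouring M colour blocked o)
  (dist : Fin (PlanarMap.nV M) → ℕ)
  (isDist : ∀ v → Setting.IsDist M colour blocked o v (dist v)) where
  open PlanarMap M
  open Setting M colour blocked o
  open Graph (edgeEnds dist)
  open Walks (edgeEnds dist)

  vtx-σ : ∀ z → vtx (σ z) ≡ vtx z
  vtx-σ z = sym (Equivalence.from (vtx-orbit z (σ z)) (1 , refl))

  face-σ : ∀ z → face (σ z) ≡ face (α z)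
  face-σ z = sym (Equivalence.from (face-orbit (α z) (σ z)) (1 , cong σ (αα z)))

  black : Fin nD → Bool
  black d = colour (face d)

  black-α : ∀ d → black (α d) ≡ not (black d)
  black-α d with black d in b | black (α d) in b'
  ... | true  | false = refl
  ... | false | true  = refl
  ... | true  | true  = ⊥-elim (proper d (trans b (sym b')))
  ... | false | false = ⊥-elim (proper d (trans b (sym b')))

  white⇒black-α : ∀ d → black d ≡ false → black (α d) ≡ true
  white⇒black-α d w = trans (black-α d) (cong not w)

  dist-o : dist o ≡ 0
  dist-o = n≤0⇒n≡0 (proj₂ (isDist o) 0 start)

  dist-suc⇒≢o : ∀ {v k} → dist v ≡ suc k → v ≢ o
  dist-suc⇒≢o dv refl with trans (sym dv) dist-o
  ... | ()

  joinsFaces : Fin nD → Bool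
  joinsFaces d = blocked d ∨ (dist (vtx (α d)) ≤ᵇ dist (vtx d))

  ends : Fin nD → MVert × MVert
  ends d = if joinsFaces d then (inj₁ (face d) , inj₁ (face (α d)))
                           else (inj₁ (face (α d)) , inj₂ (vtx (α d)))

  ends-faces : ∀ d → joinsFaces d ≡ true → ends d ≡ (inj₁ (face d) , inj₁ (face (α d)))
  ends-faces d jf rewrite jf = refl

  ends-vertex : ∀ d → joinsFaces d ≡ false → ends d ≡ (inj₁ (face (α d)) , inj₂ (vtx (α d)))
  ends-vertex d jf rewrite jf = refl

  ends-first-centre : ∀ d → ∃ λ f → proj₁ (ends d) ≡ inj₁ f
  ends-first-centre d with joinsFaces d
  ... | true  = face d , refl
  ... | false = face (α d) , refl

  faceEdge : ∀ d (bd : black d ≡ true) → joinsFaces d ≡ true →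
             Walk (inj₁ (face d)) (inj₁ (face (α d)))
  faceEdge d bd jf = edgeʷ (d , bd) (cong proj₁ (ends-faces d jf)) (cong proj₂ (ends-faces d jf))

  vertexEdge : ∀ d (bd : black d ≡ true) → joinsFaces d ≡ false →
               Walk (inj₁ (face (α d))) (inj₂ (vtx (α d)))
  vertexEdge d bd jf = edgeʷ (d , bd) (cong proj₁ (ends-vertex d jf)) (cong proj₂ (ends-vertex d jf))

  dist-step : ∀ d → black d ≡ true → blocked d ≡ false → dist (vtx (α d)) ≤ suc (dist (vtx d))
  dist-step d bd free = proj₂ (isDist _) _ (step d bd free (proj₁ (isDist (vtx d))))

  vertexEdge-dist : ∀ d → black d ≡ true → joinsFaces d ≡ false →
                    dist (vtx (α d)) ≡ suc (dist (vtx d))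
  vertexEdge-dist d bd jf =
    ≤-antisym (dist-step d bd (∨-conicalˡ _ _ jf)) (≤ᵇ≡false⇒> _ _ (∨-conicalʳ _ _ jf))

  IncomingVertexEdge : Fin nV → Set
  IncomingVertexEdge v = Σ (Fin nD) λ d → black d ≡ true × joinsFaces d ≡ false × vtx (α d) ≡ v

  -- The last edge of a shortest path to v is of type (iii).
  incoming : ∀ v → v ≢ o → IncomingVertexEdge v
  incoming v = lastStep (proj₁ (isDist v)) refl
    where
    lastStep : ∀ {u k} → Reach u k → k ≡ dist u → u ≢ o → IncomingVertexEdge u
    lastStep start                  _         u≢o = ⊥-elim (u≢o refl)
    lastStep (step {k} d bd free r) k+1≡dist _   = d , bd , jf , refl
      where
      jf : joinsFaces d ≡ false
      jf rewrite free =
        >⇒≤ᵇ≡false _ _ (subst (dist (vtx d) <_) k+1≡dist (s≤s (proj₂ (isDist (vtx d)) k r)))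

  FacesReach : Fin nV → Set
  FacesReach w = ∀ x → vtx x ≡ w → Walk (inj₁ (face x)) (inj₂ w)

  cross-or-reach : ∀ w → (∀ y → dist y ≡ suc (dist w) → FacesReach y) → ∀ x → vtx x ≡ w →
                   Walk (inj₁ (face x)) (inj₁ (face (α x))) ⊎ Walk (inj₁ (face x)) (inj₂ w)
  cross-or-reach w outer x vx≡w with black x in bx
  ... | true with joinsFaces x in jf
  ...   | true  = inj₁ (faceEdge x bx jf)
  ...   | false = inj₁ (viaOuterVertex ++ʷ reverseʷ (vertexEdge x bx jf))
    where
    viaOuterVertex : Walk (inj₁ (face x)) (inj₂ (vtx (α x)))
    viaOuterVertex = substʷ (cong inj₁ (trans (face-σ (α x)) (cong face (αα x)))) refl
      (outer (vtx (α x)) (trans (vertexEdge-dist x bx jf) (cong (suc ∘ dist) vx≡w))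
             (σ (α x)) (vtx-σ (α x)))
  cross-or-reach w outer x vx≡w | false with joinsFaces (α x) in jf
  ...   | true  = inj₁ (substʷ (cong (inj₁ ∘ face) (αα x)) refl
                          (reverseʷ (faceEdge (α x) (white⇒black-α x bx) jf)))
  ...   | false = inj₂ (substʷ (cong (inj₁ ∘ face) (αα x)) (cong inj₂ (trans (cong vtx (αα x)) vx≡w))
                          (vertexEdge (α x) (white⇒black-α x bx) jf))

  -- Turn around w from x until reaching the reverse of the incoming type (iii) edge, whose
  -- white face is joined to w; each step crosses one edge at w or already reaches w.
  facesReach-step : ∀ w → w ≢ o → (∀ y → dist y ≡ suc (dist w) → FacesReach y) → FacesReach w
  facesReach-step w w≢o outer x vx≡w with incoming w w≢o
  ... | d , bd , jf , vαd≡w =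
    let k , σᵏx≡αd = Equivalence.to (vtx-orbit x (α d)) (trans vx≡w (sym vαd≡w))
    in rotate k x vx≡w σᵏx≡αd
    where
    rotate : ∀ k x → vtx x ≡ w → iter σ k x ≡ α d → Walk (inj₁ (face x)) (inj₂ w)
    rotate zero    x _     refl = substʷ refl (cong inj₂ vαd≡w) (vertexEdge d bd jf)
    rotate (suc k) x vx≡w σᵏ⁺¹x≡αd with cross-or-reach w outer x vx≡w
    ... | inj₂ reach = reach
    ... | inj₁ cross = cross ++ʷ substʷ (cong inj₁ (face-σ x)) refl
                         (rotate k (σ x) (trans (vtx-σ x) vx≡w)
                                 (trans (sym (iter-suc σ k x)) σᵏ⁺¹x≡αd))

  facesReach : ∀ w → w ≢ o → FacesReach w
  facesReach w = below (maximum dist) w (m≤m+n _ _)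
    where
    below : ∀ n w → maximum dist ≤ n + dist w → w ≢ o → FacesReach w
    below zero    w max≤ w≢o = facesReach-step w w≢o λ y dy →
      ⊥-elim (<⇒≱ (subst (_≤ maximum dist) dy (≤-maximum dist y)) max≤)
    below (suc n) w max≤ w≢o = facesReach-step w w≢o λ y dy →
      below n y (subst (maximum dist ≤_) (trans (sym (+-suc n (dist w))) (cong (n +_) (sym dy))) max≤)
            (dist-suc⇒≢o dy)

  crossBlack : ∀ d → black d ≡ true → Walk (inj₁ (face d)) (inj₁ (face (α d)))
  crossBlack d bd with joinsFaces d in jf
  ... | true  = faceEdge d bd jf
  ... | false = substʷ (cong inj₁ (trans (face-σ (α d)) (cong face (αα d)))) refl
                  (facesReach _ (dist-suc⇒≢o (vertexEdge-dist d bd jf)) (σ (α d)) (vtx-σ (α d)))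
                ++ʷ reverseʷ (vertexEdge d bd jf)

  cross : ∀ x → Walk (inj₁ (face x)) (inj₁ (face (α x)))
  cross x with black x in bx
  ... | true  = crossBlack x bx
  ... | false = substʷ (cong (inj₁ ∘ face) (αα x)) refl
                  (reverseʷ (crossBlack (α x) (white⇒black-α x bx)))

  faces-linked : ∀ {d d'} → Conn σ α d d' → Walk (inj₁ (face d)) (inj₁ (face d'))
  faces-linked here          = []
  faces-linked (stepσ {y} c) = faces-linked c ++ʷ substʷ refl (cong inj₁ (sym (face-σ y))) (cross y)
  faces-linked (stepα {y} c) = faces-linked c ++ʷ cross y

  centres-linked : ∀ f f' → Walk (inj₁ f) (inj₁ f')
  centres-linked f f' with face-onto
  ... | inj₁ onto       = substʷ (cong inj₁ (proj₂ (onto f))) (cong inj₁ (proj₂ (onto f')))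
                            (faces-linked (connected _ _))
  ... | inj₂ (_ , nF≡1) = substʷ refl (cong inj₁ (Fin1-unique nF≡1 f f')) []

  first≢vertex : ∀ d v → proj₁ (ends d) ≢ inj₂ v
  first≢vertex d v first≡v with ends-first-centre d
  ... | _ , first≡f with trans (sym first≡v) first≡f
  ... | ()

  toCentre : ∀ x → InMVert dist x → ∃ λ f → Walk x (inj₁ f)
  toCentre (inj₁ f) _ = f , []
  toCentre (inj₂ v) ((d , _) , inj₁ first≡v) = ⊥-elim (first≢vertex d v first≡v)
  toCentre (inj₂ v) ((d , bd) , inj₂ second≡v) =
    let f , first≡f = ends-first-centre d
    in f , substʷ second≡v first≡f (reverseʷ (edgeʷ (d , bd) refl refl))

  linked : ∀ x y → InMVert dist x → InMVert dist y → Walk x y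
  linked x y x∈ y∈ =
    proj₂ (toCentre x x∈) ++ʷ (centres-linked _ _ ++ʷ reverseʷ (proj₂ (toCentre y y∈)))

  vertex∈⇔≢o : ∀ v → InMVert dist (inj₂ v) ⇔ (v ≢ o)
  vertex∈⇔≢o v = mk⇔ to from
    where
    to : InMVert dist (inj₂ v) → v ≢ o
    to ((d , _) , inj₁ first≡v) = ⊥-elim (first≢vertex d v first≡v)
    to ((d , bd) , inj₂ second≡v) with joinsFaces d in jf | second≡v
    ... | true  | ()
    ... | false | refl = dist-suc⇒≢o (vertexEdge-dist d bd jf)
    from : v ≢ o → InMVert dist (inj₂ v)
    from v≢o with incoming v v≢o
    ... | d , bd , jf , vαd≡v =
      (d , bd) , inj₂ (trans (cong proj₂ (ends-vertex d jf)) (cong inj₂ vαd≡v))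

  endpoints∈ : ∀ e → InMVert dist (proj₁ (edgeEnds dist e))
                   × InMVert dist (proj₂ (edgeEnds dist e))
  endpoints∈ e = first , second
    where
    first : InMVert dist (proj₁ (edgeEnds dist e))
    first with proj₁ (edgeEnds dist e) in eq
    ... | inj₁ _ = tt
    ... | inj₂ _ = e , inj₁ eq
    second : InMVert dist (proj₂ (edgeEnds dist e))
    second with proj₂ (edgeEnds dist e) in eq
    ... | inj₁ _ = tt
    ... | inj₂ _ = e , inj₂ eq

  blackCount : ℕ
  blackCount = count black

  centres+vertices : nF + nV ≡ blackCount + 2
  centres+vertices = *-cancelˡ-≡ _ _ 2 (begin
    2 * (nF + nV)                ≡⟨ cong (2 *_) (+-comm nF nV) ⟩
    2 * (nV + nF)                ≡⟨ euler ⟩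
    nD + 4                       ≡⟨ cong (_+ 4) (sym (count-half black α αα black-α)) ⟩
    blackCount + blackCount + 4  ≡⟨ double+4 blackCount ⟩
    2 * (blackCount + 2)         ∎)
    where
    open ≡-Reasoning
    double+4 : ∀ b → b + b + 4 ≡ 2 * (b + 2)
    double+4 = solve-∀

  N : ℕ
  N = nF + nV

  ι : MVert → Fin N
  ι = join nF nV

  module _ (d₀ : Fin nD) (black-d₀ : black d₀ ≡ true) where

    e₀ : BlackDart
    e₀ = d₀ , black-d₀

    otherBlack : Fin nD → Bool
    otherBlack d = if ⌊ d ≟ᶠ d₀ ⌋ then false else black d

    otherBlack⊆black : otherBlack ⊆ black
    otherBlack⊆black d other with d ≟ᶠ d₀
    otherBlack⊆black d ()    | yes _
    ... | no _ = other

    otherBlack-d₀ : otherBlack d₀ ≡ false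
    otherBlack-d₀ with d₀ ≟ᶠ d₀
    ... | yes _     = refl
    ... | no d₀≢d₀ = ⊥-elim (d₀≢d₀ refl)

    labelledEnds : Fin nD → Fin N × Fin N
    labelledEnds d = ι (proj₁ (ends d)) , ι (proj₂ (ends d))

    respects-others : ∀ r → Respects labelledEnds otherBlack r →
                      ∀ e → e₀ ≢ e → EdgeInvariant (r ∘ ι) e
    respects-others r respects (d , bd) e₀≢e = respects d other
      where
      other : otherBlack d ≡ true
      other with d ≟ᶠ d₀
      ... | yes refl = ⊥-elim (e₀≢e (cong (d₀ ,_) (uip black-d₀ bd)))
      ... | no _     = bd

    no-cycle-through : ∀ {x y} → Joins e₀ x y → (w : Walk y x) → All (e₀ ≢_) (walkEdges w) → ⊥
    no-cycle-through x—y w e₀∉w = <-irrefl centres+vertices (begin-strict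
      nF + nV               ≤⟨ vertices≤edges+2 labelledEnds otherBlack (ι c₀) (ι (inj₂ o)) twoComponents ⟩
      count otherBlack + 2  <⟨ +-monoˡ-< 2 (count-strict d₀ otherBlack⊆black otherBlack-d₀ black-d₀) ⟩
      blackCount + 2        ∎)
      where
      open ≤-Reasoning
      c₀ : MVert
      c₀ = proj₁ (edgeEnds dist e₀)
      -- With e₀ removed, its endpoints stay linked along the rest of the cycle.
      invariant : ∀ r → Respects labelledEnds otherBlack r → ∀ e → EdgeInvariant (r ∘ ι) e
      invariant r respects (d , bd) with d ≟ᶠ d₀
      ... | no d≢d₀ = respects-others r respects (d , bd) λ e₀≡e → d≢d₀ (sym (cong proj₁ e₀≡e))
      ... | yes refl with uip bd black-d₀
      ...   | refl = Joins⇒EdgeInvariant (r ∘ ι) {e₀} x—y (sym (walk-invariant (r ∘ ι) w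
                       (All.map (λ {e} → respects-others r respects e) e₀∉w)))
      linkedTo-c₀ : ∀ r → Respects labelledEnds otherBlack r →
                    ∀ x → InMVert dist x → r (ι x) ≡ r (ι c₀)
      linkedTo-c₀ r respects x x∈ =
        walk-invariant-all (r ∘ ι) (invariant r respects) (linked x c₀ x∈ (proj₁ (endpoints∈ e₀)))
      twoComponents : ∀ r → Respects labelledEnds otherBlack r →
                      ∀ i → r i ≡ r (ι c₀) ⊎ r i ≡ r (ι (inj₂ o))
      twoComponents r respects i with splitAt nF i | join-splitAt nF nV i
      ... | inj₁ f | refl = inj₁ (linkedTo-c₀ r respects (inj₁ f) tt)
      ... | inj₂ v | refl with v ≟ᶠ o
      ...   | yes refl = inj₂ refl
      ...   | no v≢o   =
        inj₁ (linkedTo-c₀ r respects (inj₂ v) (Equivalence.from (vertex∈⇔≢o v) v≢o))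

  acyclic : ¬ Cycle
  acyclic (_ , []                      , () , _)
  acyclic (_ , (d₀ , bd₀) ∷⟨ x—y ⟩ w , _  , (e₀∉w ∷ _) , _) = no-cycle-through d₀ bd₀ x—y w e₀∉w

  isTree : IsTree (InMVert dist)
  isTree = endpoints∈ , linked , acyclic

mainTheorem1 : (M : PlanarMap) (colour : Fin (PlanarMap.nF M) → Bool)
    (blocked : Fin (PlanarMap.nD M) → Bool) (o : Fin (PlanarMap.nV M)) →
    Setting.ProperColouring M colour blocked o →
    (∀ v → ∃ λ k → Setting.Reach M colour blocked o v k) →
    (dist : Fin (PlanarMap.nV M) → ℕ) →
    (∀ v → Setting.IsDist M colour blocked o v (dist v)) →
    Graph.IsTree (Setting.edgeEnds M colour blocked o dist)
      (Setting.InMVert M colour blocked o dist)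
    × (∀ v → Setting.InMVert M colour blocked o dist (inj₂ v) ⇔ (v ≢ o))
mainTheorem1 M colour blocked o proper _ dist isDist = isTree , vertex∈⇔≢o
  where open Construction M colour blocked o proper dist isDist
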